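{- Let $q$ be a prime power and $1<t<k<n$ integers, and let $\mathbb{S}$ be a $q$-Steiner system $S_q(t,k,n)$. Let $\mathbb{S}'$ be the multiset $\{B' : B\in\mathbb{S}\}$, where $B'\subseteq\mathbb{F}_q^{n-1}$ is obtained from $B$ by deleting the last coordinate of every vector. Then all members of $\mathbb{S}'$ are distinct, i.e., $B'\neq C'$ for any two distinct blocks $B,C\in\mathbb{S}$.
   Context: $\mathbb{F}_q$ is the finite field with $q$ elements. A $q$-Steiner system $S_q(t,k,n)$ is a collection of $k$-dimensional subspaces of $\mathbb{F}_q^n$ (blocks) such that every $t$-dimensional subspace of $\mathbb{F}_q^n$ is contained in exactly one block. -}

module Defs where

open import Level using (0ℓ)
open import Algebra.Bundles using (CommutativeRing)
open import Data.Nat using (ℕ; zero; suc; pred)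
open import Data.Fin using (Fin; zero; suc; inject₁)
open import Data.Product using (Σ; ∃; _×_; _,_)
open import Relation.Nullary using (¬_)
open import Relation.Binary.PropositionalEquality using (_≡_)

-- A finite field with exactly q elements: a commutative ring (with setoid
-- equality _≈_) in which 0 ≠ 1 and every nonzero element is invertible,
-- together with a bijection (up to ≈) between Fin q and the carrier.
-- (Every finite field has prime-power order, and for every prime power q
-- such a field exists; so quantifying over these is quantifying over F_q.)
record FiniteField (q : ℕ) : Set₁ where
  field
    commRing : CommutativeRing 0ℓ 0ℓ
  open CommutativeRing commRing public
  field
    0≉1       : ¬ (0# ≈ 1#)
    inverse   : ∀ x → ¬ (x ≈ 0#) → ∃ λ y → x * y ≈ 1#
    enum      : Fin q → Carrier
    enum-inj  : ∀ i j → enum i ≈ enum j → i ≡ j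
    enum-surj : ∀ x → ∃ λ i → enum i ≈ x

module Geometry {q : ℕ} (F : FiniteField q) where
  open FiniteField F using (Carrier; _≈_; _+_; _*_; 0#)

  V : ℕ → Set
  V n = Fin n → Carrier

  _≈v_ : ∀ {n} → V n → V n → Set
  u ≈v v = ∀ i → u i ≈ v i

  0v : ∀ {n} → V n
  0v _ = 0#

  _+v_ : ∀ {n} → V n → V n → V n
  (u +v v) i = u i + v i

  _·v_ : ∀ {n} → Carrier → V n → V n
  (a ·v v) i = a * v i

  lincomb : ∀ {k n} → (Fin k → V n) → (Fin k → Carrier) → V n
  lincomb {zero}  b c = 0v
  lincomb {suc k} b c = (c zero ·v b zero) +v lincomb (λ i → b (suc i)) (λ i → c (suc i))

  LinIndep : ∀ {k n} → (Fin k → V n) → Set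
  LinIndep b = ∀ c → lincomb b c ≈v 0v → ∀ i → c i ≈ 0#

  record Subspace (k n : ℕ) : Set where
    field
      basis : Fin k → V n
      indep : LinIndep basis

  _∈_ : ∀ {k n} → V n → Subspace k n → Set
  v ∈ S = ∃ λ c → v ≈v lincomb (Subspace.basis S) c

  _⊆_ : ∀ {t k n} → Subspace t n → Subspace k n → Set
  T ⊆ S = ∀ v → v ∈ T → v ∈ S

  _≐_ : ∀ {k n} → Subspace k n → Subspace k n → Set
  S ≐ T = S ⊆ T × T ⊆ S

  record SteinerSystem (t k n : ℕ) : Set₁ where
    field
      Index    : Set
      block    : Index → Subspace k n
      distinct : ∀ i j → block i ≐ block j → i ≡ j
      covers   : ∀ (T : Subspace t n) → ∃ λ i → T ⊆ block i
      unique   : ∀ (T : Subspace t n) i j → T ⊆ block i → T ⊆ block j → i ≡ j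

  deleteLast : ∀ {n} → V n → V (pred n)
  deleteLast {zero}  v = v
  deleteLast {suc n} v i = v (inject₁ i)

  _∈′_ : ∀ {k n} → V (pred n) → Subspace k n → Set
  u ∈′ B = ∃ λ w → w ∈ B × u ≈v deleteLast w

  SamePunctured : ∀ {k n} → Subspace k n → Subspace k n → Set
  SamePunctured {n = n} B C = ∀ (u : V (pred n)) → (u ∈′ B → u ∈′ C) × (u ∈′ C → u ∈′ B)

module Submission where

-- Let B ≠ C be blocks with B′ = C′.  Lift every basis vector b_l of B
-- to a vector c_l ∈ C agreeing with b_l off the last coordinate, so that the
-- offset ε_l = b_l - c_l lives in the last coordinate only.  Choose a pivot
-- m and scalars μ_l with ε_l + μ_l ε_m = 0 (μ = 0 if all offsets vanish,
-- otherwise ε_m ≠ 0 and μ_l = -ε_l/ε_m).  For t indices l ≠ m the vectors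
-- d_l = b_l + μ_l b_m then coincide with c_l + μ_l c_m, so they lie in
-- B ∩ C, and they are independent because the b_l are.  Their span is a
-- t-space contained in the two different blocks B and C, contradicting
-- the Steiner property.

open import Defs
open import Data.Nat using (ℕ; _<_)
open import Relation.Nullary using (¬_)
open import Relation.Binary.PropositionalEquality using (_≡_)

open import Data.Nat using (suc; _≤_; s≤s)
open import Data.Fin using (Fin; fromℕ; inject₁; inject≤; punchIn; _≟_)
open import Data.Fin.Properties
  using (all?; ¬∀⟶∃¬; inject≤-injective; punchIn-injective; punchInᵢ≢i)
open import Data.Product using (∃; _×_; _,_; proj₁; proj₂)
open import Data.Sum using (_⊎_; inj₁; inj₂)
open import Data.Maybe using (nothing)
open import Relation.Nullary using (Dec; yes; no; contradiction)
open import Relation.Binary.PropositionalEquality using (cong) renaming (refl to ≡-refl; sym to ≡-sym)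
open import Tactic.RingSolver.Core.AlmostCommutativeRing using (fromCommutativeRing)

lastOrInject₁ : ∀ {n} (p : Fin (suc n)) → p ≡ fromℕ n ⊎ ∃ λ p′ → p ≡ inject₁ p′
lastOrInject₁ {ℕ.zero}  Fin.zero    = inj₁ ≡-refl
lastOrInject₁ {suc n}   Fin.zero    = inj₂ (Fin.zero , ≡-refl)
lastOrInject₁ {suc n}   (Fin.suc p) with lastOrInject₁ p
... | inj₁ p≡last        = inj₁ (cong Fin.suc p≡last)
... | inj₂ (p′ , p≡inj)  = inj₂ (Fin.suc p′ , cong Fin.suc p≡inj)

module FieldFacts {q : ℕ} (F : FiniteField q) where
  open FiniteField F hiding (zero)
  open import Algebra.Properties.Ring ring using (-‿distribˡ-*)
  open import Algebra.Properties.AbelianGroup +-abelianGroup using (xyx⁻¹≈y)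
  open import Tactic.RingSolver.NonReflective (fromCommutativeRing commRing (λ _ → nothing))
    using (solve; _⊕_; _⊗_; _⊜_)

  -- Equality with 0 is decidable: compare positions in the enumeration.
  ≈0-dec : ∀ x → Dec (x ≈ 0#)
  ≈0-dec x with enum-surj x | enum-surj 0#
  ... | i , eᵢ≈x | j , eⱼ≈0 with i ≟ j
  ... | yes ≡-refl = yes (trans (sym eᵢ≈x) eⱼ≈0)
  ... | no i≢j     = no λ x≈0 → i≢j (enum-inj i j (trans eᵢ≈x (trans x≈0 (sym eⱼ≈0))))

  pivot : ∀ {k} (a : Fin (suc k) → Carrier) →
          ∃ λ m → ∃ λ (μ : Fin (suc k) → Carrier) → ∀ l → a l + μ l * a m ≈ 0#
  pivot {k} a with all? (λ l → ≈0-dec (a l))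
  ... | yes all≈0 =
    Fin.zero , (λ _ → 0#) , λ l → trans (+-cong (all≈0 l) (zeroˡ _)) (+-identityˡ 0#)
  ... | no ¬all≈0 with ¬∀⟶∃¬ (suc k) _ (λ l → ≈0-dec (a l)) ¬all≈0
  ... | m , aₘ≉0 with inverse (a m) aₘ≉0
  ... | y , aₘy≈1 = m , (λ l → - (a l * y)) , cleared
    where
    cleared : ∀ l → a l + - (a l * y) * a m ≈ 0#
    cleared l = begin
      a l + - (a l * y) * a m   ≈⟨ +-cong refl (sym (-‿distribˡ-* _ _)) ⟩
      a l + - (a l * y * a m)   ≈⟨ +-cong refl (-‿cong (*-assoc _ _ _)) ⟩
      a l + - (a l * (y * a m)) ≈⟨ +-cong refl (-‿cong (*-cong refl (trans (*-comm _ _) aₘy≈1))) ⟩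
      a l + - (a l * 1#)        ≈⟨ +-cong refl (-‿cong (*-identityʳ _)) ⟩
      a l + - a l               ≈⟨ -‿inverseʳ _ ⟩
      0#                        ∎
      where open import Relation.Binary.Reasoning.Setoid setoid

  add-difference : ∀ x y → x ≈ y + (x - y)
  add-difference x y = sym (trans (sym (+-assoc y x (- y))) (xyx⁻¹≈y y x))

  combine-offsets : ∀ {x x′ y y′ δx δy} μ → x ≈ x′ + δx → y ≈ y′ + δy →
                    δx + μ * δy ≈ 0# → x + μ * y ≈ x′ + μ * y′
  combine-offsets {x} {x′} {y} {y′} {δx} {δy} μ x≈ y≈ cleared = begin
    x + μ * y                            ≈⟨ +-cong x≈ (*-cong refl y≈) ⟩
    (x′ + δx) + μ * (y′ + δy)            ≈⟨ regroup x′ δx y′ δy μ ⟩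
    (x′ + μ * y′) + (δx + μ * δy)        ≈⟨ +-cong refl cleared ⟩
    (x′ + μ * y′) + 0#                   ≈⟨ +-identityʳ _ ⟩
    x′ + μ * y′                          ∎
    where
    open import Relation.Binary.Reasoning.Setoid setoid
    regroup : ∀ x′ δx y′ δy μ → (x′ + δx) + μ * (y′ + δy) ≈ (x′ + μ * y′) + (δx + μ * δy)
    regroup = solve 5 (λ x′ δx y′ δy μ →
      ((x′ ⊕ δx) ⊕ (μ ⊗ (y′ ⊕ δy))) ⊜ ((x′ ⊕ (μ ⊗ y′)) ⊕ (δx ⊕ (μ ⊗ δy)))) refl

module LinearAlgebra {q : ℕ} (F : FiniteField q) where
  open FiniteField F hiding (zero)
  open Geometry F
  open import Algebra.Properties.Semiring.Sum semiring
    using (sum; sum-syntax; sum-remove; sum-cong-≋; sum-replicate-zero;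
           ∑-distrib-+; ∑-comm; *-distribˡ-sum; *-distribʳ-sum)
  open import Relation.Binary.Reasoning.Setoid setoid

  sum-single : ∀ {k} (f : Fin k → Carrier) (l : Fin k) →
               (∀ i → ¬ i ≡ l → f i ≈ 0#) → sum f ≈ f l
  sum-single {suc k} f l off = begin
    sum f                                        ≈⟨ sum-remove f ⟩
    f l + ∑[ i < k ] f (punchIn l i)             ≈⟨ +-cong refl rest≈0 ⟩
    f l + 0#                                     ≈⟨ +-identityʳ _ ⟩
    f l                                          ∎
    where
    rest≈0 : ∑[ i < k ] f (punchIn l i) ≈ 0#
    rest≈0 = trans (sum-cong-≋ (λ i → off (punchIn l i) (punchInᵢ≢i l i))) (sum-replicate-zero k)

  lincomb-sum : ∀ {k n} (b : Fin k → V n) c p → lincomb b c p ≈ ∑[ i < k ] (c i * b i p)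
  lincomb-sum {ℕ.zero}  b c p = refl
  lincomb-sum {suc k}   b c p = +-cong refl (lincomb-sum (λ i → b (Fin.suc i)) (λ i → c (Fin.suc i)) p)

  lincomb-linear : ∀ {k n} (b : Fin k → V n) x y μ →
                   lincomb b (λ i → x i + μ * y i) ≈v (lincomb b x +v (μ ·v lincomb b y))
  lincomb-linear {k} b x y μ p = begin
    lincomb b (λ i → x i + μ * y i) p                 ≈⟨ lincomb-sum b _ p ⟩
    ∑[ i < k ] ((x i + μ * y i) * b i p)              ≈⟨ sum-cong-≋ (λ i → distribʳ (b i p) (x i) (μ * y i)) ⟩
    ∑[ i < k ] (x i * b i p + μ * y i * b i p)        ≈⟨ ∑-distrib-+ (λ i → x i * b i p) (λ i → μ * y i * b i p) ⟩
    ∑[ i < k ] (x i * b i p) + ∑[ i < k ] (μ * y i * b i p)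
      ≈⟨ +-cong (sym (lincomb-sum b x p)) (sum-cong-≋ (λ i → *-assoc μ (y i) (b i p))) ⟩
    lincomb b x p + ∑[ i < k ] (μ * (y i * b i p))    ≈⟨ +-cong refl (sym (*-distribˡ-sum μ (λ i → y i * b i p))) ⟩
    lincomb b x p + μ * ∑[ i < k ] (y i * b i p)      ≈⟨ +-cong refl (*-cong refl (sym (lincomb-sum b y p))) ⟩
    lincomb b x p + μ * lincomb b y p                 ∎

  unit : ∀ {k} → Fin k → Fin k → Carrier
  unit l i with i ≟ l
  ... | yes _ = 1#
  ... | no _  = 0#

  unit-diag : ∀ {k} (l : Fin k) → unit l l ≈ 1#
  unit-diag l with l ≟ l
  ... | yes _  = refl
  ... | no l≢l = contradiction ≡-refl l≢l

  unit-off : ∀ {k} {l i : Fin k} → ¬ i ≡ l → unit l i ≈ 0#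
  unit-off {l = l} {i} i≢l with i ≟ l
  ... | yes i≡l = contradiction i≡l i≢l
  ... | no _    = refl

  lincomb-unit : ∀ {k n} (b : Fin k → V n) l → lincomb b (unit l) ≈v b l
  lincomb-unit {k} b l p = begin
    lincomb b (unit l) p           ≈⟨ lincomb-sum b (unit l) p ⟩
    ∑[ i < k ] (unit l i * b i p)
      ≈⟨ sum-single _ l (λ i i≢l → trans (*-cong (unit-off i≢l) refl) (zeroˡ _)) ⟩
    unit l l * b l p               ≈⟨ trans (*-cong (unit-diag l) refl) (*-identityˡ _) ⟩
    b l p                          ∎

  lincomb-compose : ∀ {s k n} (b : Fin k → V n) (v : Fin s → V n) (coef : Fin s → Fin k → Carrier) →
                    (∀ j → v j ≈v lincomb b (coef j)) → ∀ a →
                    lincomb v a ≈v lincomb b (λ i → ∑[ j < s ] (a j * coef j i))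
  lincomb-compose {s} {k} b v coef v≈ a p = begin
    lincomb v a p                                    ≈⟨ lincomb-sum v a p ⟩
    ∑[ j < s ] (a j * v j p)                         ≈⟨ sum-cong-≋ (λ j → *-cong refl (trans (v≈ j p) (lincomb-sum b (coef j) p))) ⟩
    ∑[ j < s ] (a j * ∑[ i < k ] (coef j i * b i p)) ≈⟨ sum-cong-≋ (λ j → *-distribˡ-sum (a j) (λ i → coef j i * b i p)) ⟩
    ∑[ j < s ] ∑[ i < k ] (a j * (coef j i * b i p)) ≈⟨ ∑-comm (λ j i → a j * (coef j i * b i p)) ⟩
    ∑[ i < k ] ∑[ j < s ] (a j * (coef j i * b i p))
      ≈⟨ sum-cong-≋ (λ i → sum-cong-≋ (λ j → sym (*-assoc (a j) (coef j i) (b i p)))) ⟩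
    ∑[ i < k ] ∑[ j < s ] (a j * coef j i * b i p)   ≈⟨ sum-cong-≋ (λ i → sym (*-distribʳ-sum (b i p) (λ j → a j * coef j i))) ⟩
    ∑[ i < k ] (∑[ j < s ] (a j * coef j i) * b i p) ≈⟨ sym (lincomb-sum b _ p) ⟩
    lincomb b (λ i → ∑[ j < s ] (a j * coef j i)) p  ∎

  basis-∈ : ∀ {k n} (S : Subspace k n) l → Subspace.basis S l ∈ S
  basis-∈ S l = unit l , λ p → sym (lincomb-unit (Subspace.basis S) l p)

  ∈-cong : ∀ {k n} {u w : V n} (S : Subspace k n) → u ≈v w → w ∈ S → u ∈ S
  ∈-cong S u≈w (c , w≈) = c , λ p → trans (u≈w p) (w≈ p)

  ∈-combine : ∀ {k n} {u w : V n} (S : Subspace k n) μ → u ∈ S → w ∈ S → (u +v (μ ·v w)) ∈ S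
  ∈-combine S μ (x , u≈) (y , w≈) =
    (λ i → x i + μ * y i) ,
    λ p → trans (+-cong (u≈ p) (*-cong refl (w≈ p))) (sym (lincomb-linear (Subspace.basis S) x y μ p))

  basis-⊆ : ∀ {t k n} (T : Subspace t n) (S : Subspace k n) →
            (∀ j → Subspace.basis T j ∈ S) → T ⊆ S
  basis-⊆ T S basis∈S w (a , w≈) =
    (λ i → ∑[ j < _ ] (a j * proj₁ (basis∈S j) i)) ,
    λ p → trans (w≈ p) (lincomb-compose (Subspace.basis S) (Subspace.basis T)
                                        (λ j → proj₁ (basis∈S j)) (λ j → proj₂ (basis∈S j)) a p)

  shifted-indep : ∀ {t k n} (b : Fin (suc k) → V n) → LinIndep b →
                  (m : Fin (suc k)) (ι : Fin t → Fin (suc k)) →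
                  (∀ j j′ → ι j ≡ ι j′ → j ≡ j′) → (∀ j → ¬ ι j ≡ m) → (μ : Fin t → Carrier) →
                  LinIndep (λ j → b (ι j) +v (μ j ·v b m))
  shifted-indep {t} {k} b b-indep m ι ι-inj ι≢m μ a combo≈0 j₀ =
    trans (sym e-at-ι) (b-indep e combo′≈0 (ι j₀))
    where
    coef : Fin t → Fin (suc k) → Carrier
    coef j i = unit (ι j) i + μ j * unit m i

    d≈ : ∀ j → (b (ι j) +v (μ j ·v b m)) ≈v lincomb b (coef j)
    d≈ j p = sym (trans (lincomb-linear b (unit (ι j)) (unit m) (μ j) p)
                        (+-cong (lincomb-unit b (ι j) p) (*-cong refl (lincomb-unit b m p))))

    e : Fin (suc k) → Carrier
    e i = ∑[ j < t ] (a j * coef j i)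

    combo′≈0 : lincomb b e ≈v 0v
    combo′≈0 p = trans (sym (lincomb-compose b _ coef d≈ a p)) (combo≈0 p)

    coef-at-ι : ∀ j → coef j (ι j₀) ≈ unit (ι j) (ι j₀)
    coef-at-ι j = trans (+-cong refl (trans (*-cong refl (unit-off (ι≢m j₀))) (zeroʳ _))) (+-identityʳ _)

    e-at-ι : e (ι j₀) ≈ a j₀
    e-at-ι = trans (sum-single _ j₀ off) at-j₀
      where
      off : ∀ j → ¬ j ≡ j₀ → a j * coef j (ι j₀) ≈ 0#
      off j j≢j₀ = trans (*-cong refl (trans (coef-at-ι j) (unit-off (λ ι≡ → j≢j₀ (ι-inj j j₀ (≡-sym ι≡))))))
                         (zeroʳ _)
      at-j₀ : a j₀ * coef j₀ (ι j₀) ≈ a j₀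
      at-j₀ = trans (*-cong refl (trans (coef-at-ι j₀) (unit-diag (ι j₀)))) (*-identityʳ _)

module Puncturing {q : ℕ} (F : FiniteField q) where
  open FiniteField F hiding (zero)
  open Geometry F
  open FieldFacts F
  open LinearAlgebra F

  common-subspace : ∀ {t k n} → t ≤ k → (B C : Subspace (suc k) (suc n)) →
                    (∀ u → u ∈′ B → u ∈′ C) →
                    ∃ λ (T : Subspace t (suc n)) → T ⊆ B × T ⊆ C
  common-subspace {t} {k} {n} t≤k B C B′⊆C′ = shared (pivot (λ l → ε l (fromℕ n)))
    where
    b : Fin (suc k) → V (suc n)
    b = Subspace.basis B

    lift : ∀ l → ∃ λ w → w ∈ C × deleteLast (b l) ≈v deleteLast w
    lift l = B′⊆C′ (deleteLast (b l)) (b l , basis-∈ B l , λ _ → refl)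

    c : Fin (suc k) → V (suc n)
    c l = proj₁ (lift l)

    c∈C : ∀ l → c l ∈ C
    c∈C l = proj₁ (proj₂ (lift l))

    ε : Fin (suc k) → V (suc n)
    ε l p = b l p - c l p

    ε-off-last : ∀ l p′ → ε l (inject₁ p′) ≈ 0#
    ε-off-last l p′ = trans (+-cong (proj₂ (proj₂ (lift l)) p′) refl) (-‿inverseʳ _)

    ε-cleared : ∀ (m : Fin (suc k)) (μ : Fin (suc k) → Carrier) →
                (∀ l → ε l (fromℕ n) + μ l * ε m (fromℕ n) ≈ 0#) →
                ∀ l p → ε l p + μ l * ε m p ≈ 0#
    ε-cleared m μ cleared l p with lastOrInject₁ p
    ... | inj₁ ≡-refl        = cleared l
    ... | inj₂ (p′ , ≡-refl) =
      trans (+-cong (ε-off-last l p′) (trans (*-cong refl (ε-off-last m p′)) (zeroʳ _))) (+-identityˡ 0#)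

    shared : (∃ λ m → ∃ λ (μ : Fin (suc k) → Carrier) → ∀ l → ε l (fromℕ n) + μ l * ε m (fromℕ n) ≈ 0#) →
             ∃ λ (T : Subspace t (suc n)) → T ⊆ B × T ⊆ C
    shared (m , μ , cleared) = T , basis-⊆ T B d∈B , basis-⊆ T C d∈C
      where
      ι : Fin t → Fin (suc k)
      ι j = punchIn m (inject≤ j t≤k)

      ι-inj : ∀ j j′ → ι j ≡ ι j′ → j ≡ j′
      ι-inj j j′ eq = inject≤-injective t≤k t≤k j j′ (punchIn-injective m _ _ eq)

      ι≢m : ∀ j → ¬ ι j ≡ m
      ι≢m j = punchInᵢ≢i m (inject≤ j t≤k)

      d : Fin t → V (suc n)
      d j = b (ι j) +v (μ (ι j) ·v b m)

      d≈ : ∀ j → d j ≈v (c (ι j) +v (μ (ι j) ·v c m))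
      d≈ j p = combine-offsets (μ (ι j)) (add-difference _ _) (add-difference _ _) (ε-cleared m μ cleared (ι j) p)

      d∈B : ∀ j → d j ∈ B
      d∈B j = ∈-combine B (μ (ι j)) (basis-∈ B (ι j)) (basis-∈ B m)

      d∈C : ∀ j → d j ∈ C
      d∈C j = ∈-cong C (d≈ j) (∈-combine C (μ (ι j)) (c∈C (ι j)) (c∈C m))

      T : Subspace t (suc n)
      T = record { basis = d ; indep = shifted-indep b (Subspace.indep B) m ι ι-inj ι≢m (λ j → μ (ι j)) }

open Geometry.SteinerSystem using (block; unique)

theorem11 : ∀ {q : ℕ} (F : FiniteField q) (t k n : ℕ) → 1 < t → t < k → k < n →
              (S : Geometry.SteinerSystem F t k n) →
              ∀ (i j : Geometry.SteinerSystem.Index S) → ¬ (i ≡ j) →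
              ¬ Geometry.SamePunctured F (Geometry.SteinerSystem.block S i) (Geometry.SteinerSystem.block S j)
theorem11 F t (suc k) (suc n) _ (s≤s t≤k) _ S i j i≢j B′≡C′ =
  let (T , T⊆Bᵢ , T⊆Bⱼ) = Puncturing.common-subspace F t≤k (block S i) (block S j)
                                                     (λ u → proj₁ (B′≡C′ u))
  in i≢j (unique S T i j T⊆Bᵢ T⊆Bⱼ)
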